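{- For a positive integer $N$ and an admissible index $\boldsymbol{k}=(k_1,\dots,k_r)$, \[ \zeta^{\diamondsuit\star}_N(\boldsymbol{k})=\sum_{A\subset[r]^1_{\boldsymbol{k}}}\ \sum_{(n_1,\dots,n_r)\in S^{\star}_{r,N}(A)}\prod_{i\in A}\frac{1}{N-n_i}\prod_{i\in[r]\setminus A}\frac{1}{n_i^{k_i}}, \] where $S^{\star}_{r,N}(A)$ is the set of $(n_1,\dots,n_r)\in[N-1]^r$ such that for $i\in[r-1]$: $n_i\le n_{i+1}$ if $i\in A$ or $i+1\in[r]\setminus A$, and $n_i<n_{i+1}$ if $i\notin A$ and $i+1\in A$.
   Context: $[n]=\{1,\dots,n\}$. An index $\boldsymbol{k}=(k_1,\dots,k_r)$ of positive integers is admissible if $k_r\ge2$. For admissible $\boldsymbol{k}$: $[r]^1_{\boldsymbol{k}}=\{i\mid k_i=1\}$, $S_{r,N}(A)=\{(n_1,\dots,n_r)\in[N-1]^r\mid n_i\le n_{i+1}\ (i\in A),\ n_i<n_{i+1}\ (i\in[r-1]\setminus A)\}$, and \[ \zeta^{\diamondsuit}_N(\boldsymbol{k})=\sum_{A\subset[r]^1_{\boldsymbol{k}}}\sum_{(n_i)\in S_{r,N}(A)}\prod_{i\in A}\frac{1}{N-n_i}\prod_{i\in[r]\setminus A}\frac{1}{n_i^{k_i}}. \] For indices, $\boldsymbol{l}\preceq\boldsymbol{k}$ means $\boldsymbol{l}$ is obtained from $(k_1\,\square\cdots\square\,k_r)$ by replacing each $\square$ with either a comma or a plus sign. Define $\zeta^{\diamondsuit\star}_N(\boldsymbol{k})=\sum_{\boldsymbol{l}\preceq\boldsymbol{k}}\zeta^{\diamondsuit}_N(\boldsymbol{l})$.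 -}

module Defs where

open import Data.Nat using (ℕ; zero; suc; _∸_; _^_; _≤ᵇ_; _<ᵇ_; _≡ᵇ_)
open import Data.Integer using (+_)
open import Data.Bool using (Bool; true; false; _∧_; _∨_; not; if_then_else_)
open import Data.List using (List; []; _∷_; map; _++_; concatMap; length)
open import Data.Product using (_×_; _,_)
open import Data.Empty using (⊥)
open import Data.Nat using (_≤_)
open import Data.List.Relation.Unary.All using (All)
open import Data.Rational using (ℚ; 0ℚ; 1ℚ; _+_; _*_; _/_)

-- 1/n as a rational; the value at 0 is a dummy (never used: all
-- denominators occurring below are ≥ 1).
inv : ℕ → ℚ
inv zero    = 0ℚ
inv (suc n) = + 1 / suc n

sumℚ : List ℚ → ℚ
sumℚ []       = 0ℚ
sumℚ (x ∷ xs) = x + sumℚ xs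

range1 : ℕ → List ℕ
range1 zero    = []
range1 (suc m) = range1 m ++ (suc m ∷ [])

tuples : ℕ → ℕ → List (List ℕ)
tuples zero    M = [] ∷ []
tuples (suc r) M = concatMap (λ n → map (n ∷_) (tuples r M)) (range1 M)

-- all subsets A ⊂ [r]^1_k, encoded as characteristic lists (aᵢ = true iff i ∈ A)
subsets1 : List ℕ → List (List Bool)
subsets1 []       = [] ∷ []
subsets1 (k ∷ ks) =
  if k ≡ᵇ 1
  then map (true ∷_) (subsets1 ks) ++ map (false ∷_) (subsets1 ks)
  else map (false ∷_) (subsets1 ks)

chain : (Bool → Bool → ℕ → ℕ → Bool) → List Bool → List ℕ → Bool
chain c (a ∷ a' ∷ as) (n ∷ n' ∷ ns) = c a a' n n' ∧ chain c (a' ∷ as) (n' ∷ ns)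
chain c _ _ = true

condS : Bool → Bool → ℕ → ℕ → Bool
condS a a' n n' = if a then n ≤ᵇ n' else n <ᵇ n'

condS⋆ : Bool → Bool → ℕ → ℕ → Bool
condS⋆ a a' n n' = if (a ∨ not a') then n ≤ᵇ n' else n <ᵇ n'

term : ℕ → List ℕ → List Bool → List ℕ → ℚ
term N (k ∷ ks) (a ∷ as) (n ∷ ns) =
  (if a then inv (N ∸ n) else inv (n ^ k)) * term N ks as ns
term N _ _ _ = 1ℚ

diamondSum : (Bool → Bool → ℕ → ℕ → Bool) → ℕ → List ℕ → ℚ
diamondSum c N k =
  sumℚ (concatMap (λ A →
    map (λ ns → if chain c A ns then term N k A ns else 0ℚ)
        (tuples (length k) (N ∸ 1)))
    (subsets1 k))

ζ♢ : ℕ → List ℕ → ℚ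
ζ♢ = diamondSum condS

-- all l ⪯ k: each box between consecutive entries is a comma or a plus
-- refinementsFrom k ks: all l ⪯ (k ∷ ks)
refinementsFrom : ℕ → List ℕ → List (List ℕ)
refinementsFrom k []        = (k ∷ []) ∷ []
refinementsFrom k (k' ∷ ks) =
  map (k ∷_) (refinementsFrom k' ks) ++ refinementsFrom (k Data.Nat.+ k') ks

refinements : List ℕ → List (List ℕ)
refinements []       = [] ∷ []
refinements (k ∷ ks) = refinementsFrom k ks

ζ♢⋆ : ℕ → List ℕ → ℚ
ζ♢⋆ N k = sumℚ (map (ζ♢ N) (refinements k))

ζ♢⋆rhs : ℕ → List ℕ → ℚ
ζ♢⋆rhs = diamondSum condS⋆

LastGe2 : List ℕ → Set
LastGe2 []           = ⊥
LastGe2 (x ∷ [])     = 2 ≤ x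
LastGe2 (x ∷ y ∷ ys) = LastGe2 (y ∷ ys)

Admissible : List ℕ → Set
Admissible k = All (λ x → 1 ≤ x) k × LastGe2 k

{-# OPTIONS --safe #-}
-- Both sides are computed entry by entry: an index sum is a one-entry operator `layer`
-- (choose whether the first entry lies in A, and its value) applied to the sum over the
-- remaining entries, given the previous one. Summing over l ⪯ (k₁, k₂, …), the refinements
-- keeping k₁ separate give a ζ^♢-layer for k₁ applied to the sum over refinements of the
-- tail, while those merging k₁ + k₂ give, as 1/n^{k₁+k₂} = 1/n^{k₁} · 1/n^{k₂}, exactly the
-- terms with n₁ = n₂ and both entries outside A. These diagonal terms turn the strict
-- n₁ < n₂ of S into the n₁ ≤ n₂ of S⋆, and induction on the length of the index concludes.
module Submission where

open import Defs
open import Data.Nat using (ℕ; _≤_)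
open import Data.List using (List)
open import Relation.Binary.PropositionalEquality using (_≡_)

open import Algebra.Bundles using (CommutativeMonoid)
open import Data.Bool using (Bool; true; false; _∧_; if_then_else_)
open import Data.Product using (_,_)
open import Data.List using ([]; _∷_; _++_; map; concatMap; length; applyUpTo)
open import Data.List.Membership.Propositional using (_∈_)
open import Data.List.Properties using (map-++; map-∘; map-concatMap; applyUpTo-∷ʳ)
open import Data.List.Relation.Unary.All as All using (All; []; _∷_)
open import Data.List.Relation.Unary.Any as Any using (here; there)
open import Data.List.Relation.Unary.Unique.Propositional using (Unique; _∷_)
open import Data.List.Relation.Unary.Unique.Propositional.Properties using (applyUpTo⁺₁)
open import Data.Nat using (zero; suc; _∸_; _^_; _≤ᵇ_; _<ᵇ_; _≡ᵇ_; _≟_)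
import Data.Nat as ℕ
import Data.Nat.Properties as ℕ
import Data.Integer as ℤ
open import Data.Rational using (ℚ; 0ℚ; _+_; _*_; toℚᵘ)
open import Data.Rational.Properties
  using (+-identityˡ; +-identityʳ; +-assoc; *-assoc; *-zeroˡ; *-zeroʳ; *-distribˡ-+; *-distribʳ-+;
         +-0-commutativeMonoid; toℚᵘ-injective; toℚᵘ-fromℚᵘ; toℚᵘ-homo-*)
import Data.Rational.Unnormalised as ℚᵘ
import Data.Rational.Unnormalised.Properties as ℚᵘ
open import Function using (_∘_)
open import Relation.Nullary using (proof; ofʸ; ofⁿ)
open import Relation.Nullary.Decidable using (dec-false)
open import Relation.Binary.PropositionalEquality
  using (_≢_; refl; sym; trans; cong; cong₂; subst; module ≡-Reasoning)

open import Algebra.Properties.CommutativeSemigroup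
  (CommutativeMonoid.commutativeSemigroup +-0-commutativeMonoid) using (interchange)

private variable
  A B : Set

-- Valid for all m and n thanks to the junk value inv 0 = 0.
inv-* : ∀ m n → inv (m ℕ.* n) ≡ inv m * inv n
inv-* zero    n       = sym (*-zeroˡ (inv n))
inv-* (suc m) zero    rewrite ℕ.*-zeroʳ (suc m) = sym (*-zeroʳ (inv (suc m)))
inv-* (suc m) (suc n) = toℚᵘ-injective (begin
  toℚᵘ (inv (suc m ℕ.* suc n))                ≈⟨ toℚᵘ-fromℚᵘ (1/suc (n ℕ.+ m ℕ.* suc n)) ⟩
  1/suc m ℚᵘ.* 1/suc n                        ≈⟨ ℚᵘ.*-cong (ℚᵘ.≃-sym (toℚᵘ-fromℚᵘ (1/suc m)))
                                                            (ℚᵘ.≃-sym (toℚᵘ-fromℚᵘ (1/suc n))) ⟩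
  toℚᵘ (inv (suc m)) ℚᵘ.* toℚᵘ (inv (suc n))  ≈⟨ ℚᵘ.≃-sym (toℚᵘ-homo-* (inv (suc m)) (inv (suc n))) ⟩
  toℚᵘ (inv (suc m) * inv (suc n))            ∎)
  where
  open ℚᵘ.≃-Reasoning
  1/suc : ℕ → ℚᵘ.ℚᵘ
  1/suc d = ℚᵘ.mkℚᵘ (ℤ.+ 1) d

inv-^-+ : ∀ n k k′ → inv (n ^ (k ℕ.+ k′)) ≡ inv (n ^ k) * inv (n ^ k′)
inv-^-+ n k k′ = trans (cong inv (ℕ.^-distribˡ-+-* n k k′)) (inv-* (n ^ k) (n ^ k′))

∑ : List A → (A → ℚ) → ℚ
∑ xs f = sumℚ (map f xs)

syntax ∑ xs (λ x → e) = ∑[ x ← xs ] e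

sumℚ-++ : ∀ xs ys → sumℚ (xs ++ ys) ≡ sumℚ xs + sumℚ ys
sumℚ-++ []       ys = sym (+-identityˡ (sumℚ ys))
sumℚ-++ (x ∷ xs) ys = trans (cong (x +_) (sumℚ-++ xs ys)) (sym (+-assoc x (sumℚ xs) (sumℚ ys)))

sumℚ-concatMap : (g : A → List ℚ) (xs : List A) → sumℚ (concatMap g xs) ≡ ∑[ x ← xs ] sumℚ (g x)
sumℚ-concatMap g []       = refl
sumℚ-concatMap g (x ∷ xs) = trans (sumℚ-++ (g x) (concatMap g xs)) (cong (sumℚ (g x) +_) (sumℚ-concatMap g xs))

∑-++ : (xs ys : List A) (f : A → ℚ) → ∑ (xs ++ ys) f ≡ ∑ xs f + ∑ ys f
∑-++ xs ys f = trans (cong sumℚ (map-++ f xs ys)) (sumℚ-++ (map f xs) (map f ys))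

∑-map : (g : A → B) (xs : List A) (f : B → ℚ) → ∑ (map g xs) f ≡ ∑[ x ← xs ] f (g x)
∑-map g xs f = cong sumℚ (sym (map-∘ xs))

∑-concatMap : (g : A → List B) (xs : List A) (f : B → ℚ) → ∑ (concatMap g xs) f ≡ ∑[ x ← xs ] ∑ (g x) f
∑-concatMap g xs f = trans (cong sumℚ (map-concatMap f g xs)) (sumℚ-concatMap (map f ∘ g) xs)

∑-cong-∈ : (xs : List A) {f g : A → ℚ} → (∀ {x} → x ∈ xs → f x ≡ g x) → ∑ xs f ≡ ∑ xs g
∑-cong-∈ []       f≡g = refl
∑-cong-∈ (x ∷ xs) f≡g = cong₂ _+_ (f≡g (here refl)) (∑-cong-∈ xs (f≡g ∘ there))

∑-cong : (xs : List A) {f g : A → ℚ} → (∀ x → f x ≡ g x) → ∑ xs f ≡ ∑ xs g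
∑-cong xs f≡g = ∑-cong-∈ xs (λ {x} _ → f≡g x)

∑-zero : (xs : List A) → ∑[ x ← xs ] 0ℚ ≡ 0ℚ
∑-zero []       = refl
∑-zero (x ∷ xs) = trans (+-identityˡ _) (∑-zero xs)

∑-+ : (xs : List A) (f g : A → ℚ) → ∑[ x ← xs ] (f x + g x) ≡ ∑ xs f + ∑ xs g
∑-+ []       f g = sym (+-identityˡ 0ℚ)
∑-+ (x ∷ xs) f g = trans (cong (f x + g x +_) (∑-+ xs f g)) (interchange (f x) (g x) (∑ xs f) (∑ xs g))

∑-*ˡ : (c : ℚ) (xs : List A) (f : A → ℚ) → ∑[ x ← xs ] (c * f x) ≡ c * ∑ xs f
∑-*ˡ c []       f = sym (*-zeroʳ c)
∑-*ˡ c (x ∷ xs) f = trans (cong (c * f x +_) (∑-*ˡ c xs f)) (sym (*-distribˡ-+ c (f x) (∑ xs f)))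

∑-comm : (xs : List A) (ys : List B) (f : A → B → ℚ) →
  ∑[ x ← xs ] ∑[ y ← ys ] f x y ≡ ∑[ y ← ys ] ∑[ x ← xs ] f x y
∑-comm []       ys f = sym (∑-zero ys)
∑-comm (x ∷ xs) ys f =
  trans (cong (∑ ys (f x) +_) (∑-comm xs ys f)) (sym (∑-+ ys (f x) (λ y → ∑[ x ← xs ] f x y)))

∑-δ-∉ : ∀ {n} {xs : List ℕ} (f : ℕ → ℚ) → All (n ≢_) xs →
  ∑[ m ← xs ] (if n ≡ᵇ m then f m else 0ℚ) ≡ 0ℚ
∑-δ-∉ {n} {xs} f n∉xs = trans
  (∑-cong-∈ xs (λ {m} m∈xs → cong (if_then f m else 0ℚ) (dec-false (n ≟ m) (All.lookup n∉xs m∈xs))))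
  (∑-zero xs)

∑-δ : ∀ {n} {xs : List ℕ} (f : ℕ → ℚ) → Unique xs → n ∈ xs →
  ∑[ m ← xs ] (if n ≡ᵇ m then f m else 0ℚ) ≡ f n
∑-δ {n} {x ∷ xs} f (x∉xs ∷ unique) n∈ with n ≡ᵇ x | proof (n ≟ x)
... | true  | ofʸ refl = trans (cong (f n +_) (∑-δ-∉ f x∉xs)) (+-identityʳ (f n))
... | false | ofⁿ n≢x  = trans (+-identityˡ _) (∑-δ f unique (Any.tail n≢x n∈))

range1≡applyUpTo-suc : ∀ M → range1 M ≡ applyUpTo suc M
range1≡applyUpTo-suc zero    = refl
range1≡applyUpTo-suc (suc M) = trans (cong (_++ suc M ∷ []) (range1≡applyUpTo-suc M)) (applyUpTo-∷ʳ suc M)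

range1-unique : ∀ M → Unique (range1 M)
range1-unique M = subst Unique (sym (range1≡applyUpTo-suc M))
  (applyUpTo⁺₁ suc M (λ i<j _ → ℕ.<⇒≢ i<j ∘ ℕ.suc-injective))

if-∧-* : ∀ b b′ (x y : ℚ) →
  (if b ∧ b′ then x * y else 0ℚ) ≡ (if b then x else 0ℚ) * (if b′ then y else 0ℚ)
if-∧-* true  true  x y = refl
if-∧-* true  false x y = sym (*-zeroʳ x)
if-∧-* false b′    x y = sym (*-zeroˡ (if b′ then y else 0ℚ))

if-*ʳ : ∀ b (x y : ℚ) → (if b then x else 0ℚ) * y ≡ (if b then x * y else 0ℚ)
if-*ʳ true  x y = refl
if-*ʳ false x y = *-zeroˡ y

if-≤ᵇ : ∀ m n (x : ℚ) →
  (if m ≤ᵇ n then x else 0ℚ) ≡ (if m <ᵇ n then x else 0ℚ) + (if m ≡ᵇ n then x else 0ℚ)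
if-≤ᵇ zero          zero    x = sym (+-identityˡ x)
if-≤ᵇ zero          (suc n) x = sym (+-identityʳ x)
if-≤ᵇ (suc m)       zero    x = sym (+-identityˡ 0ℚ)
if-≤ᵇ (suc zero)    (suc n) x = if-≤ᵇ zero n x
if-≤ᵇ (suc (suc m)) (suc n) x = if-≤ᵇ (suc m) n x

Constraint : Set
Constraint = Bool → Bool → ℕ → ℕ → Bool

-- The possible values of the bit "entry k lies in A", for A ⊂ [r]¹ₖ.
memberships : ℕ → List Bool
memberships k = if k ≡ᵇ 1 then true ∷ false ∷ [] else false ∷ []

∑-subsets1-∷ : ∀ k ks (h : List Bool → ℚ) →
  ∑ (subsets1 (k ∷ ks)) h ≡ ∑[ a ← memberships k ] ∑[ A ← subsets1 ks ] h (a ∷ A)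
∑-subsets1-∷ k ks h with k ≡ᵇ 1
... | true  = trans (∑-++ (map (true ∷_) S) (map (false ∷_) S) h)
  (cong₂ _+_ (∑-map (true ∷_) S h) (trans (∑-map (false ∷_) S h) (sym (+-identityʳ _))))
  where S = subsets1 ks
... | false = trans (∑-map (false ∷_) (subsets1 ks) h) (sym (+-identityʳ _))

∑-memberships : ∀ k (f : Bool → ℚ) → f true ≡ 0ℚ → ∑ (memberships k) f ≡ f false
∑-memberships k f f-true≡0 with k ≡ᵇ 1
... | true  = trans (cong (_+ (f false + 0ℚ)) f-true≡0) (trans (+-identityˡ _) (+-identityʳ _))
... | false = +-identityʳ _

memberships-+ : ∀ {k k′} → 1 ≤ k → 1 ≤ k′ → memberships (k ℕ.+ k′) ≡ false ∷ []
memberships-+ {suc k} {suc k′} _ _ rewrite ℕ.+-suc k k′ = refl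

∑-tuples-suc : ∀ r M (h : List ℕ → ℚ) →
  ∑ (tuples (suc r) M) h ≡ ∑[ n ← range1 M ] ∑[ ns ← tuples r M ] h (n ∷ ns)
∑-tuples-suc r M h = trans (∑-concatMap (λ n → map (n ∷_) (tuples r M)) (range1 M) h)
  (∑-cong (range1 M) (λ n → ∑-map (n ∷_) (tuples r M) h))

weight : ℕ → Bool → ℕ → ℕ → ℚ
weight N a k n = if a then inv (N ∸ n) else inv (n ^ k)

module _ (c : Constraint) (N : ℕ) where

  -- The sum over the entries ks that follow an entry with membership bit a and value n.
  tailSum : List ℕ → Bool → ℕ → ℚ
  tailSum ks a n = ∑[ A ← subsets1 ks ] ∑[ ns ← tuples (length ks) (N ∸ 1) ]
    (if chain c (a ∷ A) (n ∷ ns) then term N ks A ns else 0ℚ)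

  coefficient : ℕ → Bool → ℕ → Bool → ℕ → ℚ
  coefficient k a n a′ n′ = if c a a′ n n′ then weight N a′ k n′ else 0ℚ

  layer : ℕ → (Bool → ℕ → ℚ) → Bool → ℕ → ℚ
  layer k g a n = ∑[ a′ ← memberships k ] ∑[ n′ ← range1 (N ∸ 1) ] (coefficient k a n a′ n′ * g a′ n′)

  tailSum-∷ : ∀ k ks a n → tailSum (k ∷ ks) a n ≡ layer k (tailSum ks) a n
  tailSum-∷ k ks a n = begin
    tailSum (k ∷ ks) a n
      ≡⟨ ∑-subsets1-∷ k ks (λ A → ∑ (tuples (suc r) M) (F A)) ⟩
    ∑[ a′ ← memberships k ] ∑[ A ← S ] ∑ (tuples (suc r) M) (F (a′ ∷ A))
      ≡⟨ ∑-cong (memberships k) (λ a′ → ∑-cong S (λ A → ∑-tuples-suc r M (F (a′ ∷ A)))) ⟩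
    ∑[ a′ ← memberships k ] ∑[ A ← S ] ∑[ n′ ← range1 M ] ∑[ ns ← T ] F (a′ ∷ A) (n′ ∷ ns)
      ≡⟨ ∑-cong (memberships k) (λ a′ → ∑-comm S (range1 M) _) ⟩
    ∑[ a′ ← memberships k ] ∑[ n′ ← range1 M ] ∑[ A ← S ] ∑[ ns ← T ] F (a′ ∷ A) (n′ ∷ ns)
      ≡⟨ ∑-cong (memberships k) (λ a′ → ∑-cong (range1 M) (factor a′)) ⟩
    layer k (tailSum ks) a n ∎
    where
    open ≡-Reasoning
    r = length ks
    M = N ∸ 1
    S = subsets1 ks
    T = tuples r M
    F : List Bool → List ℕ → ℚ
    F A ns = if chain c (a ∷ A) (n ∷ ns) then term N (k ∷ ks) A ns else 0ℚ
    factor : ∀ a′ n′ → ∑[ A ← S ] ∑[ ns ← T ] F (a′ ∷ A) (n′ ∷ ns)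
                      ≡ coefficient k a n a′ n′ * tailSum ks a′ n′
    factor a′ n′ = begin
      ∑[ A ← S ] ∑[ ns ← T ] F (a′ ∷ A) (n′ ∷ ns)
        ≡⟨ ∑-cong S (λ A → ∑-cong T (λ ns →
             if-∧-* (c a a′ n n′) (chain c (a′ ∷ A) (n′ ∷ ns)) (weight N a′ k n′) (term N ks A ns))) ⟩
      ∑[ A ← S ] ∑[ ns ← T ] (w * G A ns)  ≡⟨ ∑-cong S (λ A → ∑-*ˡ w T (G A)) ⟩
      ∑[ A ← S ] (w * ∑ T (G A))           ≡⟨ ∑-*ˡ w S (λ A → ∑ T (G A)) ⟩
      w * tailSum ks a′ n′                 ∎
      where
      w = coefficient k a n a′ n′
      G : List Bool → List ℕ → ℚ
      G A ns = if chain c (a′ ∷ A) (n′ ∷ ns) then term N ks A ns else 0ℚ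

  layer-+ : ∀ k g h a n → layer k g a n + layer k h a n ≡ layer k (λ a′ n′ → g a′ n′ + h a′ n′) a n
  layer-+ k g h a n = sym (trans
    (∑-cong (memberships k) (λ a′ → trans
      (∑-cong (range1 (N ∸ 1)) (λ n′ → *-distribˡ-+ (coefficient k a n a′ n′) (g a′ n′) (h a′ n′)))
      (∑-+ (range1 (N ∸ 1)) _ _)))
    (∑-+ (memberships k) _ _))

  layer-zero : ∀ k a n → layer k (λ _ _ → 0ℚ) a n ≡ 0ℚ
  layer-zero k a n = trans
    (∑-cong (memberships k) (λ a′ → trans
      (∑-cong (range1 (N ∸ 1)) (λ n′ → *-zeroʳ (coefficient k a n a′ n′)))
      (∑-zero (range1 (N ∸ 1)))))
    (∑-zero (memberships k))

  layer-∑ : ∀ k (G : A → Bool → ℕ → ℚ) xs a n →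
    ∑[ x ← xs ] layer k (G x) a n ≡ layer k (λ a′ n′ → ∑[ x ← xs ] G x a′ n′) a n
  layer-∑ k G []       a n = sym (layer-zero k a n)
  layer-∑ k G (x ∷ xs) a n = trans (cong (layer k (G x) a n +_) (layer-∑ k G xs a n)) (layer-+ k (G x) _ a n)

  layer-cong : ∀ k {g h} → (∀ a′ {n′} → n′ ∈ range1 (N ∸ 1) → g a′ n′ ≡ h a′ n′) →
    ∀ a n → layer k g a n ≡ layer k h a n
  layer-cong k g≡h a n = ∑-cong (memberships k) (λ a′ →
    ∑-cong-∈ (range1 (N ∸ 1)) (λ {n′} n′∈ → cong (coefficient k a n a′ n′ *_) (g≡h a′ n′∈)))

module _ (N : ℕ) where

  -- The terms of a next entry k outside A repeating the value n of an entry outside A.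
  diagonal : ℕ → (Bool → ℕ → ℚ) → Bool → ℕ → ℚ
  diagonal k g true  n = 0ℚ
  diagonal k g false n = inv (n ^ k) * g false n

  layer-merge : ∀ {k k′} → 1 ≤ k → 1 ≤ k′ → ∀ g a n →
    layer condS N (k ℕ.+ k′) g a n ≡ layer condS N k (diagonal k′ g) a n
  layer-merge {k} {k′} 1≤k 1≤k′ g a n = begin
    layer condS N (k ℕ.+ k′) g a n
      ≡⟨ cong (λ bits → ∑ bits fused) (memberships-+ 1≤k 1≤k′) ⟩
    fused false + 0ℚ
      ≡⟨ +-identityʳ (fused false) ⟩
    fused false
      ≡⟨ ∑-cong range (λ n′ → split (condS a false n n′) n′) ⟩
    repeated false
      ≡⟨ ∑-memberships k repeated
           (trans (∑-cong range (λ n′ → *-zeroʳ (coefficient condS N k a n true n′))) (∑-zero range)) ⟨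
    layer condS N k (diagonal k′ g) a n ∎
    where
    open ≡-Reasoning
    range = range1 (N ∸ 1)
    fused repeated : Bool → ℚ
    fused    a′ = ∑[ n′ ← range ] (coefficient condS N (k ℕ.+ k′) a n a′ n′ * g a′ n′)
    repeated a′ = ∑[ n′ ← range ] (coefficient condS N k a n a′ n′ * diagonal k′ g a′ n′)
    split : ∀ b n′ → (if b then inv (n′ ^ (k ℕ.+ k′)) else 0ℚ) * g false n′
                     ≡ (if b then inv (n′ ^ k) else 0ℚ) * (inv (n′ ^ k′) * g false n′)
    split true  n′ = trans (cong (_* g false n′) (inv-^-+ n′ k k′))
                           (*-assoc (inv (n′ ^ k)) (inv (n′ ^ k′)) (g false n′))
    split false n′ = trans (*-zeroˡ (g false n′)) (sym (*-zeroˡ (inv (n′ ^ k′) * g false n′)))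

  layer⋆-split : ∀ k g a {n} → n ∈ range1 (N ∸ 1) →
    layer condS⋆ N k g a n ≡ layer condS N k g a n + diagonal k g a n
  layer⋆-split k g true        _  = sym (+-identityʳ _)
  layer⋆-split k g false {n} n∈ = begin
    layer condS⋆ N k g false n
      ≡⟨ ∑-cong (memberships k) split ⟩
    ∑[ a′ ← memberships k ] (strict a′ + equal a′)
      ≡⟨ ∑-+ (memberships k) strict equal ⟩
    layer condS N k g false n + ∑ (memberships k) equal
      ≡⟨ cong (layer condS N k g false n +_) (∑-memberships k equal refl) ⟩
    layer condS N k g false n + equal false
      ≡⟨ cong (layer condS N k g false n +_)
              (∑-δ (λ n′ → inv (n′ ^ k) * g false n′) (range1-unique (N ∸ 1)) n∈) ⟩
    layer condS N k g false n + diagonal k g false n ∎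
    where
    open ≡-Reasoning
    range = range1 (N ∸ 1)
    strict equal : Bool → ℚ
    strict a′   = ∑[ n′ ← range ] (coefficient condS N k false n a′ n′ * g a′ n′)
    equal true  = 0ℚ
    equal false = ∑[ n′ ← range ] (if n ≡ᵇ n′ then inv (n′ ^ k) * g false n′ else 0ℚ)
    split : ∀ a′ → ∑[ n′ ← range ] (coefficient condS⋆ N k false n a′ n′ * g a′ n′) ≡ strict a′ + equal a′
    split true  = sym (+-identityʳ _)
    split false = trans
      (∑-cong range (λ n′ → begin
        (if n ≤ᵇ n′ then x n′ else 0ℚ) * g false n′
          ≡⟨ cong (_* g false n′) (if-≤ᵇ n n′ (x n′)) ⟩
        ((if n <ᵇ n′ then x n′ else 0ℚ) + (if n ≡ᵇ n′ then x n′ else 0ℚ)) * g false n′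
          ≡⟨ *-distribʳ-+ (g false n′) (if n <ᵇ n′ then x n′ else 0ℚ) (if n ≡ᵇ n′ then x n′ else 0ℚ) ⟩
        (if n <ᵇ n′ then x n′ else 0ℚ) * g false n′ + (if n ≡ᵇ n′ then x n′ else 0ℚ) * g false n′
          ≡⟨ cong ((if n <ᵇ n′ then x n′ else 0ℚ) * g false n′ +_) (if-*ʳ (n ≡ᵇ n′) (x n′) (g false n′)) ⟩
        (if n <ᵇ n′ then x n′ else 0ℚ) * g false n′ + (if n ≡ᵇ n′ then x n′ * g false n′ else 0ℚ) ∎))
      (∑-+ range _ _)
      where x = λ n′ → inv (n′ ^ k)

  ∑-refinementsFrom : ∀ {k} ks → 1 ≤ k → All (1 ≤_) ks → ∀ a n →
    ∑[ l ← refinementsFrom k ks ] tailSum condS N l a n ≡ layer condS N k (tailSum condS⋆ N ks) a n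
  ∑-refinementsFrom {k} []        _   []            a n = trans (+-identityʳ _) (tailSum-∷ condS N k [] a n)
  ∑-refinementsFrom {k} (k′ ∷ ks) 1≤k (1≤k′ ∷ 1≤ks) a n = begin
    ∑ (map (k ∷_) Ls ++ refinementsFrom (k ℕ.+ k′) ks) (λ l → tailSum condS N l a n)
      ≡⟨ ∑-++ (map (k ∷_) Ls) (refinementsFrom (k ℕ.+ k′) ks) (λ l → tailSum condS N l a n) ⟩
    ∑ (map (k ∷_) Ls) (λ l → tailSum condS N l a n)
      + ∑[ l ← refinementsFrom (k ℕ.+ k′) ks ] tailSum condS N l a n
      ≡⟨ cong₂ _+_ separated merged ⟩
    layer condS N k (layer condS N k′ g) a n + layer condS N k (diagonal k′ g) a n
      ≡⟨ layer-+ condS N k (layer condS N k′ g) (diagonal k′ g) a n ⟩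
    layer condS N k (λ a′ n′ → layer condS N k′ g a′ n′ + diagonal k′ g a′ n′) a n
      ≡⟨ layer-cong condS N k (λ a′ {n′} n′∈ →
           sym (trans (tailSum-∷ condS⋆ N k′ ks a′ n′) (layer⋆-split k′ g a′ n′∈))) a n ⟩
    layer condS N k (tailSum condS⋆ N (k′ ∷ ks)) a n ∎
    where
    open ≡-Reasoning
    Ls = refinementsFrom k′ ks
    g = tailSum condS⋆ N ks
    separated : ∑ (map (k ∷_) Ls) (λ l → tailSum condS N l a n)
                ≡ layer condS N k (layer condS N k′ g) a n
    separated = begin
      ∑ (map (k ∷_) Ls) (λ l → tailSum condS N l a n)
        ≡⟨ ∑-map (k ∷_) Ls (λ l → tailSum condS N l a n) ⟩
      ∑[ l ← Ls ] tailSum condS N (k ∷ l) a n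
        ≡⟨ ∑-cong Ls (λ l → tailSum-∷ condS N k l a n) ⟩
      ∑[ l ← Ls ] layer condS N k (tailSum condS N l) a n
        ≡⟨ layer-∑ condS N k (tailSum condS N) Ls a n ⟩
      layer condS N k (λ a′ n′ → ∑[ l ← Ls ] tailSum condS N l a′ n′) a n
        ≡⟨ layer-cong condS N k (λ a′ {n′} _ → ∑-refinementsFrom ks 1≤k′ 1≤ks a′ n′) a n ⟩
      layer condS N k (layer condS N k′ g) a n ∎
    merged : ∑[ l ← refinementsFrom (k ℕ.+ k′) ks ] tailSum condS N l a n
             ≡ layer condS N k (diagonal k′ g) a n
    merged = trans (∑-refinementsFrom ks (ℕ.≤-trans 1≤k (ℕ.m≤m+n k k′)) 1≤ks a n)
                   (layer-merge 1≤k 1≤k′ g a n)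

chain-∷-true-0 : (c : Constraint) → (∀ a n → c true a 0 n ≡ true) → ∀ A ns →
  chain c (true ∷ A) (0 ∷ ns) ≡ chain c A ns
chain-∷-true-0 c c-true-0 []           ns       = refl
chain-∷-true-0 c c-true-0 (a ∷ [])     []       = refl
chain-∷-true-0 c c-true-0 (a ∷ a′ ∷ A) []       = refl
chain-∷-true-0 c c-true-0 (a ∷ A)      (n ∷ ns) rewrite c-true-0 a n = refl

diamondSum≡tailSum : (c : Constraint) → (∀ a n → c true a 0 n ≡ true) → ∀ N ks →
  diamondSum c N ks ≡ tailSum c N ks true 0
diamondSum≡tailSum c c-true-0 N ks = trans (sumℚ-concatMap _ (subsets1 ks))
  (∑-cong (subsets1 ks) (λ A → ∑-cong (tuples (length ks) (N ∸ 1)) (λ ns →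
    cong (if_then term N ks A ns else 0ℚ) (sym (chain-∷-true-0 c c-true-0 A ns)))))

ζ♢⋆≡ζ♢⋆rhs : ∀ N k → All (1 ≤_) k → ζ♢⋆ N k ≡ ζ♢⋆rhs N k
ζ♢⋆≡ζ♢⋆rhs N []       []          = +-identityʳ _
ζ♢⋆≡ζ♢⋆rhs N (k ∷ ks) (1≤k ∷ 1≤ks) = begin
  ζ♢⋆ N (k ∷ ks)
    ≡⟨ ∑-cong (refinementsFrom k ks) (diamondSum≡tailSum condS (λ _ _ → refl) N) ⟩
  ∑[ l ← refinementsFrom k ks ] tailSum condS N l true 0
    ≡⟨ ∑-refinementsFrom N ks 1≤k 1≤ks true 0 ⟩
  layer condS N k (tailSum condS⋆ N ks) true 0
    ≡⟨ tailSum-∷ condS⋆ N k ks true 0 ⟨  -- after an entry in A, condS and condS⋆ coincide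
  tailSum condS⋆ N (k ∷ ks) true 0
    ≡⟨ diamondSum≡tailSum condS⋆ (λ _ _ → refl) N (k ∷ ks) ⟨
  ζ♢⋆rhs N (k ∷ ks) ∎
  where open ≡-Reasoning

proposition3p3 : (N : ℕ) → 1 ≤ N → (k : List ℕ) → Admissible k →
    ζ♢⋆ N k ≡ ζ♢⋆rhs N k
proposition3p3 N _ k (1≤k , _) = ζ♢⋆≡ζ♢⋆rhs N k 1≤k
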